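{- There exists a forward simulation from $TS_{PP}$ to $TS_{PSO}$, i.e.\ a relation $F\subseteq\Sigma_{PP}\times\Sigma_{PSO}$ with $F(\sigma_0)\cap I_{PSO}\neq\emptyset$ for all $\sigma_0\in I_{PP}$ such that for all threads $t$ and all $a\in{\sf Act}$: $(\sigma_1,\sigma_2)\in F \land (\sigma_1,\sigma_1')\in T_{PP}(t,a) \Rightarrow \exists \sigma_2' : (\sigma_2,\sigma_2')\in T_{PSO}(t,a)\land(\sigma_1',\sigma_2')\in F$.
   Context: Programs run over threads $\mathsf{Tid}$, global variables ${\sf Var_G}$, local registers ${\sf Var_L}$, values ${\sf Val}$; actions are ${\sf Act}=\{rd(x,r,v),wr(x,v),fence\}$. Relational composition is written $R\,;\,R'$ (first $R$, then $R'$). PSO: states $(s,wb)\in\Sigma_{PSO}$ with shared memory $s:{\sf Var_G}\to{\sf Val}$ and a FIFO write buffer $wb^{t,x}\in{\sf Val}^*$ for each thread $t$ and variable $x$. A write $wr(x,v)$ by $t$ appends $v$ to $wb^{t,x}$; a read $rd(x,r,v)$ by $t$ requires $v$ to be the last entry of $wb^{t,x}$ if nonempty, else $s(x)$, and leaves the state unchanged; a fence by $t$ requires all $wb^{t,x}$ empty and leaves the state unchanged; a flush step of $t$ removes the first entry $v$ of some $wb^{t,x}$ and sets $s(x):=v$. Initial states $I_{PSO}$ have all buffers empty. $T_{PSO}(t,a)=FL_{PSO}\,;\,\overset{a,t}{\leadsto}_{PSO}$ where $FL_{PSO}$ is the reflexive-transitive closure of the union of all flush steps. Prophetic PSO (PPSO):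 states $(s,wb)\in\Sigma_{PP}$ with $s:{\sf Var_G}\to{\sf Val}$ and $wb^{t,x}\in({\sf Val}\times\mathbb{Q})^*$ (value, timestamp). PP-Write: $wr(x,v)$ by $t$ appends $(v,q)$ to $wb^{t,x}$ provided $fresh_\sigma(t,x,q)$: $q$ occurs as timestamp in no buffer and $q$ exceeds all timestamps in $wb^{t,x}$. PP-Read: $rd(x,r,v)$ by $t$ requires $v=val_\sigma(t,x)$ (value of last entry of $wb^{t,x}$ if nonempty, else $s(x)$), state unchanged. PP-Fence: requires all $wb^{t,x}$ of $t$ empty, state unchanged. PP-Flush of $t$: if $wb^{t,x}=\langle(v,q)\rangle\cdot w$ and $q$ is smaller than every timestamp in every other buffer $wb^{t',x'}$ ($(t',x')\neq(t,x)$), set $s(x):=v$ and $wb^{t,x}:=w$. $I_{PP}$: all buffers empty. $FL_{PP}=(\bigcup_t\overset{flush,t}{\leadsto}_{PP})^*$ and $T_{PP}(t,a)=FL_{PP}\,;\,\overset{a,t}{\leadsto}_{PP}$. $TS_{PP}=({\sf Act},\Sigma_{PP},I_{PP},T_{PP})$, $TS_{PSO}=({\sf Act},\Sigma_{PSO},I_{PSO},T_{PSO})$. -}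

module Defs where

open import Data.Product using (Σ; ∃; ∃-syntax; _×_; _,_)
open import Data.List using (List; []; _∷_; _++_; [_])
open import Data.List.Relation.Unary.All using (All)
open import Data.List.Relation.Unary.Any using (Any)
open import Data.Rational using (ℚ; _<_)
open import Relation.Binary.PropositionalEquality using (_≡_)
open import Relation.Nullary using (¬_)
open import Relation.Binary.Construct.Closure.ReflexiveTransitive using (Star)

lastOr : {A : Set} → List A → A → A
lastOr []       d = d
lastOr (a ∷ []) d = a
lastOr (a ∷ b ∷ w) d = lastOr (b ∷ w) d

_⨾_ : {A : Set} → (A → A → Set) → (A → A → Set) → A → A → Set
(R ⨾ S) a c = ∃[ b ] (R a b × S b c)

⋃ : {I A : Set} → (I → A → A → Set) → A → A → Set
⋃ {I} R a b = ∃[ i ] R i a b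

module Models (Tid VarG VarL Val : Set) where

  data Act : Set where
    rd    : VarG → VarL → Val → Act
    wr    : VarG → Val → Act
    fence : Act

  _,_≢_,_ : Tid → VarG → Tid → VarG → Set
  t' , x' ≢ t , x = ¬ (t' ≡ t × x' ≡ x)

  record ΣPSO : Set where
    constructor pso
    field
      mem : VarG → Val
      wb  : Tid → VarG → List Val
  open ΣPSO

  _≈PSO_ : ΣPSO → ΣPSO → Set
  σ ≈PSO σ' = (∀ x → mem σ' x ≡ mem σ x) × (∀ t x → wb σ' t x ≡ wb σ t x)

  IPSO : ΣPSO → Set
  IPSO σ = ∀ t x → wb σ t x ≡ []

  valPSO : ΣPSO → Tid → VarG → Val
  valPSO σ t x = lastOr (wb σ t x) (mem σ x)

  stepPSO : Tid → Act → ΣPSO → ΣPSO → Set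
  stepPSO t (wr x v) σ σ' =
    (∀ y → mem σ' y ≡ mem σ y) ×
    (wb σ' t x ≡ wb σ t x ++ [ v ]) ×
    (∀ t' x' → t' , x' ≢ t , x → wb σ' t' x' ≡ wb σ t' x')
  stepPSO t (rd x r v) σ σ' = (v ≡ valPSO σ t x) × (σ ≈PSO σ')
  stepPSO t fence σ σ' = (∀ x → wb σ t x ≡ []) × (σ ≈PSO σ')

  flushPSO : Tid → ΣPSO → ΣPSO → Set
  flushPSO t σ σ' = ∃[ x ] ∃[ v ] ∃[ w ]
    (wb σ t x ≡ v ∷ w) × (wb σ' t x ≡ w) × (mem σ' x ≡ v) ×
    (∀ y → ¬ (y ≡ x) → mem σ' y ≡ mem σ y) ×
    (∀ t' x' → t' , x' ≢ t , x → wb σ' t' x' ≡ wb σ t' x')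

  FLPSO : ΣPSO → ΣPSO → Set
  FLPSO = Star (⋃ flushPSO)

  TPSO : Tid → Act → ΣPSO → ΣPSO → Set
  TPSO t a = FLPSO ⨾ stepPSO t a

  record ΣPP : Set where
    constructor pp
    field
      mem : VarG → Val
      wb  : Tid → VarG → List (Val × ℚ)
  open ΣPP renaming (mem to memP; wb to wbP)

  _≈PP_ : ΣPP → ΣPP → Set
  σ ≈PP σ' = (∀ x → memP σ' x ≡ memP σ x) × (∀ t x → wbP σ' t x ≡ wbP σ t x)

  IPP : ΣPP → Set
  IPP σ = ∀ t x → wbP σ t x ≡ []

  ts : Val × ℚ → ℚ
  ts (_ , q) = q

  valPP : ΣPP → Tid → VarG → Val
  valPP σ t x = lastOr (Data.List.map (λ { (v , _) → v }) (wbP σ t x)) (memP σ x)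
    where import Data.List

  fresh : ΣPP → Tid → VarG → ℚ → Set
  fresh σ t x q =
    (∀ t' x' → ¬ Any (λ e → ts e ≡ q) (wbP σ t' x')) ×
    All (λ e → ts e < q) (wbP σ t x)

  stepPP : Tid → Act → ΣPP → ΣPP → Set
  stepPP t (wr x v) σ σ' = ∃[ q ]
    (fresh σ t x q) ×
    (∀ y → memP σ' y ≡ memP σ y) ×
    (wbP σ' t x ≡ wbP σ t x ++ [ (v , q) ]) ×
    (∀ t' x' → t' , x' ≢ t , x → wbP σ' t' x' ≡ wbP σ t' x')
  stepPP t (rd x r v) σ σ' = (v ≡ valPP σ t x) × (σ ≈PP σ')
  stepPP t fence σ σ' = (∀ x → wbP σ t x ≡ []) × (σ ≈PP σ')

  flushPP : Tid → ΣPP → ΣPP → Set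
  flushPP t σ σ' = ∃[ x ] ∃[ v ] ∃[ q ] ∃[ w ]
    (wbP σ t x ≡ (v , q) ∷ w) ×
    (∀ t' x' → t' , x' ≢ t , x → All (λ e → q < ts e) (wbP σ t' x')) ×
    (wbP σ' t x ≡ w) × (memP σ' x ≡ v) ×
    (∀ y → ¬ (y ≡ x) → memP σ' y ≡ memP σ y) ×
    (∀ t' x' → t' , x' ≢ t , x → wbP σ' t' x' ≡ wbP σ t' x')

  FLPP : ΣPP → ΣPP → Set
  FLPP = Star (⋃ flushPP)

  TPP : Tid → Act → ΣPP → ΣPP → Set
  TPP t a = FLPP ⨾ stepPP t a

  IsForwardSim : (ΣPP → ΣPSO → Set) → Set
  IsForwardSim F =
    (∀ σ₀ → IPP σ₀ → ∃[ τ ] (F σ₀ τ × IPSO τ)) ×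
    (∀ t a σ₁ σ₂ σ₁' → F σ₁ σ₂ → TPP t a σ₁ σ₁' →
       ∃[ σ₂' ] (TPSO t a σ₂ σ₂' × F σ₁' σ₂'))

-- Forgetting the timestamps maps every PPSO state to a PSO state. A PPSO flush
-- is a PSO flush with an extra side condition on timestamps, and writes, reads
-- and fences are the same operations on the erased buffers (a read sees the
-- same value because erasure commutes with taking the last entry). Hence
-- "the PSO state is the erasure of the PPSO state" is a forward simulation.
{-# OPTIONS --safe #-}
module Submission where

open import Defs
open import Data.Product using (Σ; ∃-syntax; _×_; _,_; proj₁)
open import Data.List using (map; _++_; [_])
open import Data.List.Properties using (map-++)
open import Relation.Binary.PropositionalEquality using (_≡_; refl; sym; trans; cong; cong₂; module ≡-Reasoning)
open import Relation.Binary.Construct.Closure.ReflexiveTransitive using (ε; _◅_)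

module Erasure (Tid VarG VarL Val : Set) where
  open Models Tid VarG VarL Val
  open ΣPSO
  open ΣPP renaming (mem to memP; wb to wbP)
  open ≡-Reasoning

  erase : ΣPP → ΣPSO
  erase σ = pso (memP σ) (λ t x → map proj₁ (wbP σ t x))

  Erases : ΣPP → ΣPSO → Set
  Erases σ τ = erase σ ≈PSO τ

  ≈PSO-refl : ∀ τ → τ ≈PSO τ
  ≈PSO-refl τ = (λ _ → refl) , (λ _ _ → refl)

  erases-erase : ∀ σ → Erases σ (erase σ)
  erases-erase σ = ≈PSO-refl (erase σ)

  erases-≈PP : ∀ {σ σ' τ} → σ ≈PP σ' → Erases σ τ → Erases σ' τ
  erases-≈PP (em , ew) (fm , fw) =
    (λ x → trans (fm x) (sym (em x))) ,
    (λ t x → trans (fw t x) (cong (map proj₁) (sym (ew t x))))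

  erases-initial : ∀ {σ} → IPP σ → ∃[ τ ] (Erases σ τ × IPSO τ)
  erases-initial {σ} empty = erase σ , erases-erase σ , λ t x → cong (map proj₁) (empty t x)

  erase-flush : ∀ {t σ σ' τ} → Erases σ τ → flushPP t σ σ' → flushPSO t τ (erase σ')
  erase-flush {t} (fm , fw) (x , v , q , w , head , _ , tail , write , others-mem , others-wb) =
    x , v , map proj₁ w ,
    trans (fw t x) (cong (map proj₁) head) ,
    cong (map proj₁) tail ,
    write ,
    (λ y y≢x → trans (others-mem y y≢x) (sym (fm y))) ,
    (λ t' x' tx'≢tx → trans (cong (map proj₁) (others-wb t' x' tx'≢tx)) (sym (fw t' x')))

  erase-flushes : ∀ {σ σ' τ} → Erases σ τ → FLPP σ σ' → ∃[ τ' ] (FLPSO τ τ' × Erases σ' τ')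
  erase-flushes {τ = τ} e ε = τ , ε , e
  erase-flushes e (_◅_ {j = σ₁} (t , flush) flushes)
    with erase-flushes (erases-erase σ₁) flushes
  ... | τ' , flushes' , e' = τ' , (t , erase-flush e flush) ◅ flushes' , e'

  erase-step : ∀ {t a σ σ' τ} → Erases σ τ → stepPP t a σ σ' →
               ∃[ τ' ] (stepPSO t a τ τ' × Erases σ' τ')
  erase-step {t} {wr x v} {σ} {σ'} {τ} (fm , fw) (q , _ , mem≡ , appended , others) =
    erase σ' ,
    ((λ y → trans (mem≡ y) (sym (fm y))) ,
     erased-append ,
     (λ t' x' tx'≢tx → trans (cong (map proj₁) (others t' x' tx'≢tx)) (sym (fw t' x')))) ,
    erases-erase σ'
    where
    erased-append : map proj₁ (wbP σ' t x) ≡ wb τ t x ++ [ v ]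
    erased-append = begin
      map proj₁ (wbP σ' t x)               ≡⟨ cong (map proj₁) appended ⟩
      map proj₁ (wbP σ t x ++ [ (v , q) ]) ≡⟨ map-++ proj₁ (wbP σ t x) [ (v , q) ] ⟩
      map proj₁ (wbP σ t x) ++ [ v ]       ≡⟨ cong (_++ [ v ]) (sym (fw t x)) ⟩
      wb τ t x ++ [ v ]                    ∎

  erase-step {t} {rd x r v} {τ = τ} e@(fm , fw) (v≡ , unchanged) =
    τ , (trans v≡ (sym (cong₂ lastOr (fw t x) (fm x))) , ≈PSO-refl τ) , erases-≈PP unchanged e
  erase-step {t} {fence} {τ = τ} e@(fm , fw) (empty , unchanged) =
    τ , ((λ x → trans (fw t x) (cong (map proj₁) (empty x))) , ≈PSO-refl τ) , erases-≈PP unchanged e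

  erase-transition : ∀ {t a σ σ' τ} → Erases σ τ → TPP t a σ σ' →
                     ∃[ τ' ] (TPSO t a τ τ' × Erases σ' τ')
  erase-transition e (σ₁ , flushes , step) with erase-flushes e flushes
  ... | τ₁ , flushes' , e₁ with erase-step e₁ step
  ... | τ' , step' , e' = τ' , (τ₁ , flushes' , step') , e'

theorem1 : (Tid VarG VarL Val : Set) → let open Models Tid VarG VarL Val in
    Σ (ΣPP → ΣPSO → Set) IsForwardSim
theorem1 Tid VarG VarL Val =
  Erases , (λ _ → erases-initial) , (λ _ _ _ _ _ → erase-transition)
  where open Erasure Tid VarG VarL Val
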